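{- Let $\pi$ be a permutation of $[n]$ avoiding $2341$, $4123$ and $3412$ with $\pi(1)>\pi(n)$. Then $\pi$ has one of the following two forms (where any of the pieces may be empty): (i) the positions $1,\dots,n$ can be split into three consecutive (possibly empty) blocks $S_1,S_2,S_3$ (in left-to-right order) and the values $1,\dots,n$ into five consecutive (possibly empty) intervals $V_1<V_2<V_3<V_4<V_5$ such that the entries in positions $S_1$ have values in $V_1\cup V_4$, the entries in positions $S_2$ have values in $V_3$, the entries in positions $S_3$ have values in $V_2\cup V_5$, and for each $j\in\{1,\dots,5\}$ the entries with values in $V_j$ form a decreasing subsequence; (ii) $\pi$ is the concatenation $\alpha\beta$ of two (possibly empty) decreasing sequences $\alpha$ and $\beta$.
   Context: A permutation $\pi$ contains $\tau$ if $\pi$ has a subsequence order-isomorphic to $\tau$; otherwise it avoids $\tau$. -}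

module Defs where

open import Data.Nat using (ℕ; zero; suc; _<_; _≤_)
open import Data.Fin using (Fin; toℕ)
open import Data.Fin.Permutation using (Permutation′; _⟨$⟩ʳ_)
open import Data.Product using (Σ; _×_; ∃-syntax)
open import Data.Sum using (_⊎_)
open import Function using (_⇔_)

pat4 : ℕ → ℕ → ℕ → ℕ → Fin 4 → ℕ
pat4 a b c d Fin.zero = a
pat4 a b c d (Fin.suc Fin.zero) = b
pat4 a b c d (Fin.suc (Fin.suc Fin.zero)) = c
pat4 a b c d (Fin.suc (Fin.suc (Fin.suc Fin.zero))) = d

p2341 p4123 p3412 : Fin 4 → ℕ
p2341 = pat4 2 3 4 1
p4123 = pat4 4 1 2 3
p3412 = pat4 3 4 1 2

val : ∀ {n} → Permutation′ n → Fin n → ℕ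
val π i = toℕ (π ⟨$⟩ʳ i)

Contains : ∀ {n k} → Permutation′ n → (Fin k → ℕ) → Set
Contains {n} {k} π τ =
  Σ (Fin k → Fin n) λ ι →
    (∀ a b → toℕ a < toℕ b → toℕ (ι a) < toℕ (ι b)) ×
    (∀ a b → (val π (ι a) < val π (ι b)) ⇔ (τ a < τ b))

Avoids : ∀ {n k} → Permutation′ n → (Fin k → ℕ) → Set
Avoids π τ = Contains π τ → Data.Empty.⊥
  where import Data.Empty

InI : ℕ → ℕ → ℕ → Set
InI lo hi x = lo ≤ x × x < hi

DecIn : ∀ {n} → Permutation′ n → ℕ → ℕ → Set
DecIn π lo hi = ∀ p q → toℕ p < toℕ q →
  InI lo hi (val π p) → InI lo hi (val π q) → val π q < val π p

-- Positions (0-based) are split by cut points a ≤ b ≤ n into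
-- S₁ = [0,a), S₂ = [a,b), S₃ = [b,n); values (0-based) are split by cut points
-- c₁ ≤ c₂ ≤ c₃ ≤ c₄ ≤ n into V₁ = [0,c₁), V₂ = [c₁,c₂), V₃ = [c₂,c₃),
-- V₄ = [c₃,c₄), V₅ = [c₄,n).
FormI : ∀ {n} → Permutation′ n → Set
FormI {n} π =
  ∃[ a ] ∃[ b ] ∃[ c₁ ] ∃[ c₂ ] ∃[ c₃ ] ∃[ c₄ ]
    (a ≤ b × b ≤ n × c₁ ≤ c₂ × c₂ ≤ c₃ × c₃ ≤ c₄ × c₄ ≤ n) ×
    (∀ p → InI 0 a (toℕ p) → InI 0 c₁ (val π p) ⊎ InI c₃ c₄ (val π p)) ×
    (∀ p → InI a b (toℕ p) → InI c₂ c₃ (val π p)) ×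
    (∀ p → InI b n (toℕ p) → InI c₁ c₂ (val π p) ⊎ InI c₄ n (val π p)) ×
    (DecIn π 0 c₁ × DecIn π c₁ c₂ × DecIn π c₂ c₃ × DecIn π c₃ c₄ × DecIn π c₄ n)

-- Form (ii): π = αβ with α (positions [0,k)) and β (positions [k,n)) decreasing.
FormII : ∀ {n} → Permutation′ n → Set
FormII {n} π =
  ∃[ k ] k ≤ n ×
    (∀ p q → toℕ p < toℕ q → (toℕ q < k ⊎ k ≤ toℕ p) → val π q < val π p)

-- Let lo = π(n) < hi = π(1) and call a value small, middle or large according as it lies below,
-- in, or above [lo, hi].  The small values decrease (4123 through π(1) and π(n)), so do the large
-- ones (2341), and every small entry precedes every large one (3412).  If the middle values
-- decrease too, cutting the positions after the last small entry gives form (i).  Otherwise a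
-- middle ascent holds every small and large entry strictly between its two positions, and π splits
-- into two decreasing runs after the last small entry, or before the first large one.  With neither,
-- π(1) = n and π(n) = 1, so π avoids 123 and 3412: take c least such that the values ≥ c decrease.
-- If the values < c decrease too, this is form (i); if not, an ascent below c crosses an ascent at
-- c - 1 in a pattern 3142, and the two decreasing runs meet in the middle of a tightest such 3142.

module Submission where

open import Defs
open import Data.Nat using (ℕ; zero; suc; _<_; _≤_; _>_; z≤n; s≤s; s≤s⁻¹; _<?_; _≤?_)
open import Data.Nat.Properties
open import Data.Fin as Fin using (Fin; zero; suc; toℕ; fromℕ; inject₁; #_)
open import Data.Fin.Properties as Finₚ
  using (toℕ-injective; toℕ<n; toℕ-fromℕ; toℕ-inject₁; ≤fromℕ; any?)
open import Data.Fin.Permutation using (Permutation′; _⟨$⟩ˡ_; inverseˡ)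
open import Data.Vec using ([]; _∷_; lookup)
open import Data.Product using (_×_; _,_; proj₁; proj₂; ∃-syntax; ∃₂)
open import Data.Sum using (_⊎_; inj₁; inj₂)
open import Data.Empty using (⊥; ⊥-elim)
open import Function using (_∘_; id; mk⇔; Equivalence)
open import Relation.Nullary using (¬_; Dec; yes; no)
open import Relation.Nullary.Decidable using (_×-dec_)
open import Relation.Unary using (Pred; Decidable)
open import Relation.Binary using (Rel; Transitive; Tri; tri<; tri≈; tri>)
open import Relation.Binary.PropositionalEquality
  using (_≡_; _≢_; refl; sym; trans; cong; subst; subst₂)

searchFirst : ∀ {n ℓ} {P : Pred (Fin n) ℓ} → Decidable P →
              (∀ i → ¬ P i) ⊎ ∃[ i ] P i × (∀ j → j Fin.< i → ¬ P j)
searchFirst {zero} P? = inj₁ λ ()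
searchFirst {suc n} P? with P? zero
... | yes P0 = inj₂ (zero , P0 , λ _ ())
... | no ¬P0 with searchFirst (P? ∘ suc)
...   | inj₁ none = inj₁ λ { zero → ¬P0 ; (suc i) → none i }
...   | inj₂ (i , Pi , before) =
        inj₂ (suc i , Pi , λ { zero _ → ¬P0 ; (suc j) j<i → before j (s≤s⁻¹ j<i) })

searchLast : ∀ {n ℓ} {P : Pred (Fin n) ℓ} → Decidable P →
             (∀ i → ¬ P i) ⊎ ∃[ i ] P i × (∀ j → i Fin.< j → ¬ P j)
searchLast {zero} P? = inj₁ λ ()
searchLast {suc n} P? with searchLast (P? ∘ suc)
... | inj₂ (i , Pi , after) = inj₂ (suc i , Pi , λ { (suc j) i<j → after j (s≤s⁻¹ i<j) })
... | inj₁ none with P? zero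
...   | yes P0 = inj₂ (zero , P0 , λ { (suc j) _ → none j })
...   | no ¬P0 = inj₁ λ { zero → ¬P0 ; (suc i) → none i }

chain⇒ordered : ∀ {a ℓ} {A : Set a} {R : Rel A ℓ} → Transitive R →
                ∀ {k} (g : Fin (suc k) → A) → (∀ i → R (g (inject₁ i)) (g (suc i))) →
                ∀ {i j} → i Fin.< j → R (g i) (g j)
chain⇒ordered R-trans {suc k} g step {zero} {suc zero} _ = step zero
chain⇒ordered {R = R} R-trans {suc k} g step {zero} {suc (suc j)} _ =
  R-trans (step zero) (chain⇒ordered {R = R} R-trans (g ∘ suc) (step ∘ suc) {zero} {suc j} (s≤s z≤n))
chain⇒ordered {R = R} R-trans {suc k} g step {suc i} {suc j} i<j =
  chain⇒ordered {R = R} R-trans (g ∘ suc) (step ∘ suc) (s≤s⁻¹ i<j)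

p123 : Fin 3 → ℕ
p123 a = suc (toℕ a)

InI? : ∀ lo hi x → Dec (InI lo hi x)
InI? lo hi x = (lo ≤? x) ×-dec (x <? hi)

module Entries {n} (π : Permutation′ n) where

  private
    v : Fin n → ℕ
    v = val π

  val-injective : ∀ {p q} → v p ≡ v q → p ≡ q
  val-injective eq =
    trans (sym (inverseˡ π)) (trans (cong (π ⟨$⟩ˡ_) (toℕ-injective eq)) (inverseˡ π))

  compare-val : ∀ p q → Tri (v p < v q) (p ≡ q) (v q < v p)
  compare-val p q with <-cmp (v p) (v q)
  ... | tri< lt ≢ ≯ = tri< lt (≢ ∘ cong v) ≯
  ... | tri≈ ≮ eq ≯ = tri≈ ≮ (val-injective eq) ≯
  ... | tri> ≮ ≢ gt = tri> ≮ (≢ ∘ cong v) gt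

  descent : ∀ {p q} → p Fin.< q → ¬ v p < v q → v q < v p
  descent {p} {q} p<q ¬vp<vq with compare-val p q
  ... | tri< vp<vq _ _ = ⊥-elim (¬vp<vq vp<vq)
  ... | tri≈ _ refl _ = ⊥-elim (<-irrefl refl p<q)
  ... | tri> _ _ vq<vp = vq<vp

  record AscentIn (lo hi : ℕ) (i j : Fin n) : Set where
    constructor ascent
    field
      i<j : i Fin.< j
      vi<vj : v i < v j
      i-in : InI lo hi (v i)
      j-in : InI lo hi (v j)

  decreasing? : ∀ lo hi → DecIn π lo hi ⊎ ∃₂ (AscentIn lo hi)
  decreasing? lo hi with any? (λ i → any? (λ j →
    (toℕ i <? toℕ j) ×-dec (v i <? v j) ×-dec InI? lo hi (v i) ×-dec InI? lo hi (v j)))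
  ... | yes (i , j , i<j , vi<vj , i-in , j-in) = inj₂ (i , j , ascent i<j vi<vj i-in j-in)
  ... | no none = inj₁ λ p q p<q p-in q-in →
          descent p<q λ vp<vq → none (p , q , p<q , vp<vq , p-in , q-in)

  DecIn? : ∀ lo hi → Dec (DecIn π lo hi)
  DecIn? lo hi with decreasing? lo hi
  ... | inj₁ dec = yes dec
  ... | inj₂ (i , j , ascent i<j vi<vj i-in j-in) =
          no λ dec → <-asym vi<vj (dec i j i<j i-in j-in)

  DecIn-mono : ∀ {lo hi lo′ hi′} → lo ≤ lo′ → hi′ ≤ hi → DecIn π lo hi → DecIn π lo′ hi′
  DecIn-mono lo≤lo′ hi′≤hi dec p q p<q (lo′≤vp , vp<hi′) (lo′≤vq , vq<hi′) =
    dec p q p<q (≤-trans lo≤lo′ lo′≤vp , <-≤-trans vp<hi′ hi′≤hi)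
                (≤-trans lo≤lo′ lo′≤vq , <-≤-trans vq<hi′ hi′≤hi)

  DecIn-empty : ∀ {c} → DecIn π c c
  DecIn-empty p q _ (c≤vp , vp<c) _ = ⊥-elim (<⇒≱ vp<c c≤vp)

  decreasing-halves⇒FormI : ∀ c → c ≤ n → DecIn π 0 c → DecIn π c n → FormI π
  decreasing-halves⇒FormI c c≤n low high =
    0 , 0 , 0 , c , c , c , (z≤n , z≤n , z≤n , ≤-refl , ≤-refl , c≤n) ,
    (λ { _ (_ , ()) }) , (λ { _ (_ , ()) }) , halves ,
    (DecIn-empty , low , DecIn-empty , DecIn-empty , high)
    where
    halves : ∀ p → InI 0 n (toℕ p) → InI 0 c (v p) ⊎ InI c n (v p)
    halves p _ with v p <? c
    ... | yes vp<c = inj₁ (z≤n , vp<c)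
    ... | no vp≮c = inj₂ (≮⇒≥ vp≮c , toℕ<n _)

  -- σ lists the entries of the occurrence by increasing value; τ a = 1 + ρ a is the rank of its a-th entry.
  occurrence : ∀ {k} (τ : Fin (suc k) → ℕ) (ρ : Fin (suc k) → Fin (suc k)) (σ : Fin (suc k) → Fin n) →
               (∀ a → τ a ≡ suc (toℕ (ρ a))) →
               (∀ a → σ (ρ (inject₁ a)) Fin.< σ (ρ (suc a))) →
               (∀ i → v (σ (inject₁ i)) < v (σ (suc i))) →
               Contains π τ
  occurrence τ ρ σ rank positions values =
    σ ∘ ρ , (λ a b → chain⇒ordered {R = _<_} <-trans (toℕ ∘ σ ∘ ρ) positions) ,
    λ a b → mk⇔ (backward a b) (forward a b)
    where
    ordered : ∀ {i j} → i Fin.< j → v (σ i) < v (σ j)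
    ordered = chain⇒ordered {R = _<_} <-trans (v ∘ σ) values
    forward : ∀ a b → τ a < τ b → v (σ (ρ a)) < v (σ (ρ b))
    forward a b τa<τb = ordered (s≤s⁻¹ (subst₂ _<_ (rank a) (rank b) τa<τb))
    backward : ∀ a b → v (σ (ρ a)) < v (σ (ρ b)) → τ a < τ b
    backward a b lt with <-cmp (toℕ (ρ a)) (toℕ (ρ b))
    ... | tri< ρa<ρb _ _ = subst₂ _<_ (sym (rank a)) (sym (rank b)) (s≤s ρa<ρb)
    ... | tri≈ _ ρa≡ρb _ = ⊥-elim (<-irrefl (cong (v ∘ σ) (toℕ-injective ρa≡ρb)) lt)
    ... | tri> _ _ ρb<ρa = ⊥-elim (<-asym lt (ordered ρb<ρa))

  contains123 : ∀ {p q r} → p Fin.< q → q Fin.< r → v p < v q → v q < v r → Contains π p123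
  contains123 {p} {q} {r} p<q q<r x y = occurrence p123 id (lookup (p ∷ q ∷ r ∷ [])) (λ _ → refl)
    (λ { zero → p<q ; (suc zero) → q<r }) (λ { zero → x ; (suc zero) → y })

  module _ {p q r s : Fin n} (p<q : p Fin.< q) (q<r : q Fin.< r) (r<s : r Fin.< s) where

    contains2341 : v s < v p → v p < v q → v q < v r → Contains π p2341
    contains2341 x y z =
      occurrence p2341 (lookup (# 1 ∷ # 2 ∷ # 3 ∷ # 0 ∷ [])) (lookup (s ∷ p ∷ q ∷ r ∷ []))
      (λ { zero → refl ; (suc zero) → refl ; (suc (suc zero)) → refl ; (suc (suc (suc zero))) → refl })
      (λ { zero → p<q ; (suc zero) → q<r ; (suc (suc zero)) → r<s })
      (λ { zero → x ; (suc zero) → y ; (suc (suc zero)) → z })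

    contains4123 : v q < v r → v r < v s → v s < v p → Contains π p4123
    contains4123 x y z =
      occurrence p4123 (lookup (# 3 ∷ # 0 ∷ # 1 ∷ # 2 ∷ [])) (lookup (q ∷ r ∷ s ∷ p ∷ []))
      (λ { zero → refl ; (suc zero) → refl ; (suc (suc zero)) → refl ; (suc (suc (suc zero))) → refl })
      (λ { zero → p<q ; (suc zero) → q<r ; (suc (suc zero)) → r<s })
      (λ { zero → x ; (suc zero) → y ; (suc (suc zero)) → z })

    contains3412 : v r < v s → v s < v p → v p < v q → Contains π p3412
    contains3412 x y z =
      occurrence p3412 (lookup (# 2 ∷ # 3 ∷ # 0 ∷ # 1 ∷ [])) (lookup (r ∷ s ∷ p ∷ q ∷ []))
      (λ { zero → refl ; (suc zero) → refl ; (suc (suc zero)) → refl ; (suc (suc (suc zero))) → refl })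
      (λ { zero → p<q ; (suc zero) → q<r ; (suc (suc zero)) → r<s })
      (λ { zero → x ; (suc zero) → y ; (suc (suc zero)) → z })

module Avoiding123And3412 {n} {π : Permutation′ n}
  (avoid123 : Avoids π p123) (avoid3412 : Avoids π p3412) where

  open Entries π

  private
    v : Fin n → ℕ
    v = val π

  no123 : ∀ {p q r} → p Fin.< q → q Fin.< r → v p < v q → v q < v r → ⊥
  no123 p<q q<r x y = avoid123 (contains123 p<q q<r x y)

  no3412 : ∀ {p q r s} → p Fin.< q → q Fin.< r → r Fin.< s → v r < v s → v s < v p → v p < v q → ⊥
  no3412 p<q q<r r<s x y z = avoid3412 (contains3412 p<q q<r r<s x y z)

  record Occurrence3142 (a b c d : Fin n) : Set where
    field
      a<b : a Fin.< b
      b<c : b Fin.< c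
      c<d : c Fin.< d
      vb<vd : v b < v d
      vd<va : v d < v a
      va<vc : v a < v c

  crossing-ascents⇒3142 : ∀ {p q p′ q′} → p Fin.< q → v p < v q → p′ Fin.< q′ → v p′ < v q′ →
                          v q ≤ v p′ → Occurrence3142 p′ p q′ q
  crossing-ascents⇒3142 {p} {q} {p′} {q′} p<q vp<vq p′<q′ vp′<vq′ vq≤vp′ =
    record { a<b = p′<p ; b<c = p<q′ ; c<d = q′<q
           ; vb<vd = vp<vq ; vd<va = vq<vp′ ; va<vc = vp′<vq′ }
    where
    vq<vp′ : v q < v p′
    vq<vp′ with compare-val q p′
    ... | tri< lt _ _ = lt
    ... | tri≈ _ refl _ = ⊥-elim (no123 p<q p′<q′ vp<vq vp′<vq′)
    ... | tri> _ _ gt = ⊥-elim (<⇒≱ gt vq≤vp′)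
    p′<p : p′ Fin.< p
    p′<p with Finₚ.<-cmp p′ p
    ... | tri< lt _ _ = lt
    ... | tri≈ _ refl _ = ⊥-elim (<-asym vp<vq vq<vp′)
    ... | tri> _ _ p<p′ = ⊥-elim (no123 p<p′ p′<q′ (<-trans vp<vq vq<vp′) vp′<vq′)
    q′<q : q′ Fin.< q
    q′<q with Finₚ.<-cmp q′ q
    ... | tri< lt _ _ = lt
    ... | tri≈ _ refl _ = ⊥-elim (<-asym vq<vp′ vp′<vq′)
    ... | tri> _ _ q<q′ = ⊥-elim (no123 p<q q<q′ vp<vq (<-trans vq<vp′ vp′<vq′))
    p<q′ : p Fin.< q′
    p<q′ with Finₚ.<-cmp p q′
    ... | tri< lt _ _ = lt
    ... | tri≈ _ refl _ = ⊥-elim (<-asym (<-trans vp<vq vq<vp′) vp′<vq′)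
    ... | tri> _ _ q′<p = ⊥-elim (no3412 p′<q′ q′<p p<q vp<vq vq<vp′ vp′<vq′)

  -- Moving c to the first position after b whose value exceeds v a clears the gap between b and c.
  tighten : ∀ {a b c d} → Occurrence3142 a b c d →
            ∃[ y ] Occurrence3142 a b y d × (∀ x → b Fin.< x → x Fin.< y → v x < v b)
  tighten {a} {b} {c} {d} o with searchFirst (λ y → (toℕ b <? toℕ y) ×-dec (v a <? v y))
  ... | inj₁ none = ⊥-elim (none c (b<c , va<vc))
    where open Occurrence3142 o
  ... | inj₂ (y , (b<y , va<vy) , y-first) =
    y , record { a<b = a<b ; b<c = b<y ; c<d = y<d ; vb<vd = vb<vd ; vd<va = vd<va ; va<vc = va<vy } ,
    gap
    where
    open Occurrence3142 o
    y<d : y Fin.< d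
    y<d = ≤-<-trans (≮⇒≥ λ c<y → y-first c c<y (b<c , va<vc)) c<d
    below-a : ∀ x → b Fin.< x → x Fin.< y → v x < v a
    below-a x b<x x<y with compare-val x a
    ... | tri< lt _ _ = lt
    ... | tri≈ _ refl _ = ⊥-elim (<-asym a<b b<x)
    ... | tri> _ _ va<vx = ⊥-elim (y-first x x<y (b<x , va<vx))
    gap : ∀ x → b Fin.< x → x Fin.< y → v x < v b
    gap x b<x x<y with compare-val x b
    ... | tri< lt _ _ = lt
    ... | tri≈ _ refl _ = ⊥-elim (<-irrefl refl b<x)
    ... | tri> _ _ vb<vx = ⊥-elim (no123 b<x x<y vb<vx (<-trans (below-a x b<x x<y) va<vy))

  tight3142⇒FormII : ∀ {a b y d} → Occurrence3142 a b y d →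
                     (∀ x → b Fin.< x → x Fin.< y → v x < v b) → FormII π
  tight3142⇒FormII {a} {b} {y} {d} o gap =
    toℕ y , <⇒≤ (toℕ<n y) , λ p q p<q side → descent p<q (split side p<q)
    where
    open Occurrence3142 o renaming (b<c to b<y ; c<d to y<d ; va<vc to va<vy)
    a<y : a Fin.< y
    a<y = <-trans a<b b<y
    b<d : b Fin.< d
    b<d = <-trans b<y y<d
    before : ∀ {p q} → p Fin.< q → q Fin.< y → ¬ v p < v q
    before {p} {q} p<q q<y vp<vq with Finₚ.<-cmp q b | compare-val q y
    ... | tri> _ _ b<q | _ = no123 p<q (<-trans q<y y<d) vp<vq (<-trans (gap q b<q q<y) vb<vd)
    ... | tri≈ _ refl _ | _ = no123 p<q b<d vp<vq vb<vd
    ... | tri< _ _ _ | tri< vq<vy _ _ = no123 p<q q<y vp<vq vq<vy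
    ... | tri< _ _ _ | tri≈ _ refl _ = <-irrefl refl q<y
    ... | tri< q<b _ _ | tri> _ _ vy<vq with compare-val p a | Finₚ.<-cmp p a
    ...   | tri> _ _ va<vp | _ = no3412 p<q q<b b<d vb<vd (<-trans vd<va va<vp) vp<vq
    ...   | tri≈ _ refl _ | _ = no3412 p<q q<b b<d vb<vd vd<va vp<vq
    ...   | tri< vp<va _ _ | tri< p<a _ _ = no123 p<a a<y vp<va va<vy
    ...   | tri< vp<va _ _ | tri≈ _ refl _ = <-irrefl refl vp<va
    ...   | tri< _ _ _ | tri> _ _ a<p =
            no3412 (<-trans a<p p<q) q<b b<d vb<vd vd<va (<-trans va<vy vy<vq)
    after : ∀ {p q} → y Fin.≤ p → p Fin.< q → ¬ v p < v q
    after {p} {q} y≤p p<q vp<vq with compare-val b p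
    ... | tri< vb<vp _ _ = no123 (<-≤-trans b<y y≤p) p<q vb<vp vp<vq
    ... | tri≈ _ refl _ = <⇒≱ b<y y≤p
    ... | tri> _ _ vp<vb with Finₚ.<-cmp p d
    ...   | tri≈ _ refl _ = <-asym vp<vb vb<vd
    ...   | tri< p<d _ _ = no3412 a<y y<p p<d (<-trans vp<vb vb<vd) vd<va va<vy
      where
      y<p : y Fin.< p
      y<p = Finₚ.≤∧≢⇒< y≤p λ { refl → <-asym vp<vb (<-trans vb<vd (<-trans vd<va va<vy)) }
    ...   | tri> _ _ d<p with compare-val q a
    ...     | tri< vq<va _ _ = no3412 a<y (<-trans y<d d<p) p<q vp<vq vq<va va<vy
    ...     | tri≈ _ refl _ = <-asym (<-≤-trans a<y y≤p) p<q
    ...     | tri> _ _ va<vq = no123 b<d (<-trans d<p p<q) vb<vd (<-trans vd<va va<vq)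
    split : ∀ {p q} → (toℕ q < toℕ y ⊎ toℕ y ≤ toℕ p) → p Fin.< q → ¬ v p < v q
    split (inj₁ q<y) p<q = before p<q q<y
    split (inj₂ y≤p) p<q = after y≤p p<q

  ascent-below-least-cut⇒FormII : ∀ {c : Fin (suc n)} {p q} →
                                  (∀ (d : Fin (suc n)) → d Fin.< c → ¬ DecIn π (toℕ d) n) →
                                  AscentIn 0 (toℕ c) p q → FormII π
  ascent-below-least-cut⇒FormII {zero} _ (ascent _ _ _ (_ , ()))
  ascent-below-least-cut⇒FormII {suc c} c-least (ascent p<q vp<vq _ (_ , vq≤c))
      with decreasing? (toℕ (inject₁ c)) n
  ... | inj₁ high = ⊥-elim (c-least (inject₁ c) (s≤s (≤-reflexive (toℕ-inject₁ c))) high)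
  ... | inj₂ (_ , _ , ascent p′<q′ vp′<vq′ (c≤vp′ , _) _)
      with tighten (crossing-ascents⇒3142 p<q vp<vq p′<q′ vp′<vq′
                     (≤-trans (s≤s⁻¹ vq≤c) (subst (_≤ _) (toℕ-inject₁ c) c≤vp′)))
  ...   | y , o , gap = tight3142⇒FormII o gap

  form : FormI π ⊎ FormII π
  form with searchFirst (λ (c : Fin (suc n)) → DecIn? (toℕ c) n)
  ... | inj₁ none =
        ⊥-elim (none (fromℕ n) (subst (λ c → DecIn π c n) (sym (toℕ-fromℕ n)) DecIn-empty))
  ... | inj₂ (c , high , c-least) with decreasing? 0 (toℕ c)
  ...   | inj₁ low = inj₁ (decreasing-halves⇒FormI (toℕ c) (s≤s⁻¹ (toℕ<n c)) low high)
  ...   | inj₂ (_ , _ , low-ascent) = inj₂ (ascent-below-least-cut⇒FormII c-least low-ascent)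

avoids123∧3412⇒form : ∀ {n} {π : Permutation′ n} → Avoids π p123 → Avoids π p3412 →
                      FormI π ⊎ FormII π
avoids123∧3412⇒form {π = π} = Avoiding123And3412.form {π = π}

module FirstAboveLast {m} {π : Permutation′ (suc m)}
  (avoid2341 : Avoids π p2341) (avoid4123 : Avoids π p4123) (avoid3412 : Avoids π p3412)
  (hi>lo : val π zero > val π (fromℕ m)) where

  open Entries π

  private
    v : Fin (suc m) → ℕ
    v = val π

  start end : Fin (suc m)
  start = zero
  end = fromℕ m

  hi lo : ℕ
  hi = v start
  lo = v end

  Small Middle Large : ℕ → Set
  Small x = x < lo
  Middle = InI lo (suc hi)
  Large x = hi < x

  classify : ∀ x → Small x ⊎ Middle x ⊎ Large x
  classify x with x <? lo | hi <? x
  ... | yes small | _ = inj₁ small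
  ... | no _ | yes large = inj₂ (inj₂ large)
  ... | no ¬small | no ¬large = inj₂ (inj₁ (≮⇒≥ ¬small , s≤s (≮⇒≥ ¬large)))

  after-start : ∀ {p} → v p ≢ hi → start Fin.< p
  after-start {zero} ≢hi = ⊥-elim (≢hi refl)
  after-start {suc p} _ = s≤s z≤n

  before-end : ∀ {p} → v p ≢ lo → p Fin.< end
  before-end {p} ≢lo = Finₚ.≤∧≢⇒< (≤fromℕ p) (≢lo ∘ cong v)

  below-hi : ∀ {p q : Fin (suc m)} → p Fin.< q → v q ≤ hi → v q < hi
  below-hi {p} {q} p<q vq≤hi =
    ≤∧≢⇒< vq≤hi λ eq → <-irrefl (cong toℕ (sym (val-injective eq))) (≤-<-trans z≤n p<q)

  above-lo : ∀ {p q : Fin (suc m)} → p Fin.< q → lo ≤ v p → lo < v p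
  above-lo {p} {q} p<q lo≤vp =
    ≤∧≢⇒< lo≤vp λ eq → <⇒≱ (subst (Fin._< q) (val-injective (sym eq)) p<q) (≤fromℕ q)

  small-decreasing : DecIn π 0 lo
  small-decreasing p q p<q (_ , p-small) (_ , q-small) = descent p<q λ vp<vq →
    avoid4123 (contains4123 (after-start (<⇒≢ (<-trans p-small hi>lo))) p<q (before-end (<⇒≢ q-small))
                            vp<vq q-small hi>lo)

  large-decreasing : DecIn π (suc hi) (suc m)
  large-decreasing p q p<q (p-large , _) (q-large , _) = descent p<q λ vp<vq →
    avoid2341 (contains2341 (after-start (>⇒≢ p-large)) p<q (before-end (>⇒≢ (<-trans hi>lo q-large)))
                            hi>lo p-large vp<vq)

  small-before-large : ∀ {p q} → Small (v p) → Large (v q) → p Fin.< q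
  small-before-large {p} {q} p-small q-large with Finₚ.<-cmp p q
  ... | tri< p<q _ _ = p<q
  ... | tri≈ _ refl _ = ⊥-elim (<-asym p-small (<-trans hi>lo q-large))
  ... | tri> _ _ q<p = ⊥-elim (avoid3412
        (contains3412 (after-start (>⇒≢ q-large)) q<p (before-end (<⇒≢ p-small)) p-small hi>lo q-large))

  smalls-inside : ∀ {i j p} → AscentIn lo (suc hi) i j → Small (v p) → i Fin.< p × p Fin.< j
  smalls-inside {i} {j} {p} (ascent i<j vi<vj (lo≤vi , _) (_ , vj≤hi)) p-small = i<p , p<j
    where
    i<p : i Fin.< p
    i<p with Finₚ.<-cmp i p
    ... | tri< i<p _ _ = i<p
    ... | tri≈ _ refl _ = ⊥-elim (<⇒≱ p-small lo≤vi)
    ... | tri> _ _ p<i = ⊥-elim (avoid4123 (contains4123 (after-start (<⇒≢ (<-trans p-small hi>lo)))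
                                  p<i i<j
                                  (<-≤-trans p-small lo≤vi) vi<vj (below-hi i<j (s≤s⁻¹ vj≤hi))))
    p<j : p Fin.< j
    p<j with Finₚ.<-cmp p j
    ... | tri< p<j _ _ = p<j
    ... | tri≈ _ refl _ = ⊥-elim (<⇒≱ p-small (≤-trans lo≤vi (<⇒≤ vi<vj)))
    ... | tri> _ _ j<p = ⊥-elim (avoid3412 (contains3412 i<j j<p (before-end (<⇒≢ p-small))
                                  p-small (above-lo i<j lo≤vi) vi<vj))

  larges-inside : ∀ {i j r} → AscentIn lo (suc hi) i j → Large (v r) → i Fin.< r × r Fin.< j
  larges-inside {i} {j} {r} (ascent i<j vi<vj (lo≤vi , _) (_ , vj≤hi)) r-large = i<r , r<j
    where
    vj<hi : v j < hi
    vj<hi = below-hi i<j (s≤s⁻¹ vj≤hi)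
    i<r : i Fin.< r
    i<r with Finₚ.<-cmp i r
    ... | tri< i<r _ _ = i<r
    ... | tri≈ _ refl _ = ⊥-elim (<-asym r-large (<-trans vi<vj vj<hi))
    ... | tri> _ _ r<i =
          ⊥-elim (avoid3412 (contains3412 (after-start (>⇒≢ r-large)) r<i i<j vi<vj vj<hi r-large))
    r<j : r Fin.< j
    r<j with Finₚ.<-cmp r j
    ... | tri< r<j _ _ = r<j
    ... | tri≈ _ refl _ = ⊥-elim (<-asym r-large vj<hi)
    ... | tri> _ _ j<r = ⊥-elim (avoid2341 (contains2341 i<j j<r (before-end (>⇒≢ (<-trans hi>lo r-large)))
                                  (above-lo i<j lo≤vi) vi<vj (<-trans vj<hi r-large)))

  Middle? : ∀ x → Dec (Middle x)
  Middle? = InI? lo (suc hi)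

  -- The middle values are cut at the first middle entry q after position k: those before k lie
  -- above v q, those after k at or below it.
  middle-decreasing⇒FormI-at : DecIn π lo (suc hi) → ∀ k →
                               (∀ p → toℕ p < k → ¬ Large (v p)) → (∀ p → k ≤ toℕ p → ¬ Small (v p)) →
                               k ≤ toℕ end → FormI π
  middle-decreasing⇒FormI-at middle-decreasing k S₁-not-large S₃-not-small k≤end
      with searchFirst (λ q → (k ≤? toℕ q) ×-dec Middle? (v q))
  ... | inj₁ none = ⊥-elim (none end (k≤end , ≤-refl , s≤s (<⇒≤ hi>lo)))
  ... | inj₂ (q , (k≤q , q-middle@(lo≤vq , vq≤hi)) , q-first) =
    k , k , lo , suc (v q) , suc (v q) , suc hi ,
    (≤-refl , ≤-trans k≤end (<⇒≤ (toℕ<n end)) , ≤-trans lo≤vq (n≤1+n _) , ≤-refl , vq≤hi , toℕ<n _) ,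
    S₁ , (λ p (k≤p , p<k) → ⊥-elim (<⇒≱ p<k k≤p)) , S₃ ,
    (small-decreasing , DecIn-mono ≤-refl vq≤hi middle-decreasing , DecIn-empty ,
     DecIn-mono (≤-trans lo≤vq (n≤1+n _)) ≤-refl middle-decreasing , large-decreasing)
    where
    S₁ : ∀ p → InI 0 k (toℕ p) → InI 0 lo (v p) ⊎ InI (suc (v q)) (suc hi) (v p)
    S₁ p (_ , p<k) with classify (v p)
    ... | inj₁ p-small = inj₁ (z≤n , p-small)
    ... | inj₂ (inj₁ p-middle) =
          inj₂ (middle-decreasing p q (<-≤-trans p<k k≤q) p-middle q-middle , proj₂ p-middle)
    ... | inj₂ (inj₂ p-large) = ⊥-elim (S₁-not-large p p<k p-large)
    vp≤vq : ∀ p → k ≤ toℕ p → Middle (v p) → v p ≤ v q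
    vp≤vq p k≤p p-middle with Finₚ.<-cmp q p
    ... | tri< q<p _ _ = <⇒≤ (middle-decreasing q p q<p q-middle p-middle)
    ... | tri≈ _ refl _ = ≤-refl
    ... | tri> _ _ p<q = ⊥-elim (q-first p p<q (k≤p , p-middle))
    S₃ : ∀ p → InI k (suc m) (toℕ p) → InI lo (suc (v q)) (v p) ⊎ InI (suc hi) (suc m) (v p)
    S₃ p (k≤p , _) with classify (v p)
    ... | inj₁ p-small = ⊥-elim (S₃-not-small p k≤p p-small)
    ... | inj₂ (inj₁ p-middle) = inj₁ (proj₁ p-middle , s≤s (vp≤vq p k≤p p-middle))
    ... | inj₂ (inj₂ p-large) = inj₂ (p-large , toℕ<n _)

  middle-decreasing⇒FormI : DecIn π lo (suc hi) → FormI π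
  middle-decreasing⇒FormI middle-decreasing with searchLast (λ p → v p <? lo)
  ... | inj₁ no-small = middle-decreasing⇒FormI-at middle-decreasing 0 (λ _ ()) (λ p _ → no-small p) z≤n
  ... | inj₂ (s , s-small , s-last) =
        middle-decreasing⇒FormI-at middle-decreasing (suc (toℕ s))
          (λ p p≤s p-large → <⇒≱ (small-before-large s-small p-large) (s≤s⁻¹ p≤s))
          (λ p s<p → s-last p s<p) (before-end (<⇒≢ s-small))

  last-small⇒FormII : ∀ {i j s} → AscentIn lo (suc hi) i j → Small (v s) →
                      (∀ q → s Fin.< q → ¬ Small (v q)) → FormII π
  last-small⇒FormII {i} {j} {s} middle-ascent s-small s-last =
    suc (toℕ s) , toℕ<n s , λ p q p<q side → descent p<q (split side p<q)
    where
    open AscentIn middle-ascent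
    before : ∀ {p q} → p Fin.< q → q Fin.≤ s → ¬ v p < v q
    before {p} {q} p<q q≤s vp<vq with classify (v q) | classify (v p)
    ... | inj₁ q-small | _ =
          <-asym vp<vq (small-decreasing p q p<q (z≤n , <-trans vp<vq q-small) (z≤n , q-small))
    ... | inj₂ (inj₂ q-large) | _ = <⇒≱ (small-before-large s-small q-large) q≤s
    ... | inj₂ (inj₁ q-middle) | inj₂ (inj₁ p-middle) =
          <⇒≱ (proj₂ (smalls-inside (ascent p<q vp<vq p-middle q-middle) s-small)) q≤s
    ... | inj₂ (inj₁ _) | inj₂ (inj₂ p-large) =
          <⇒≱ (<-trans (small-before-large s-small p-large) p<q) q≤s
    ... | inj₂ (inj₁ q-middle) | inj₁ p-small with compare-val q j
    ...   | tri< vq<vj _ _ = avoid4123 (contains4123 (after-start (<⇒≢ (<-trans p-small hi>lo))) p<q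
                               (≤-<-trans q≤s (proj₂ (smalls-inside middle-ascent s-small)))
                               vp<vq vq<vj (below-hi i<j (s≤s⁻¹ (proj₂ j-in))))
    ...   | tri≈ _ refl _ = <⇒≱ (proj₂ (smalls-inside middle-ascent s-small)) q≤s
    ...   | tri> _ _ vj<vq = <⇒≱ (proj₂ (smalls-inside i-q-ascent s-small)) q≤s
      where
      i-q-ascent : AscentIn lo (suc hi) i q
      i-q-ascent = ascent (<-trans (proj₁ (smalls-inside middle-ascent p-small)) p<q) (<-trans vi<vj vj<vq)
                          i-in q-middle
    after : ∀ {p q} → s Fin.< p → p Fin.< q → ¬ v p < v q
    after {p} {q} s<p p<q vp<vq with classify (v p) | classify (v q)
    ... | inj₁ p-small | _ = s-last p s<p p-small
    ... | inj₂ (inj₂ p-large) | _ =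
          <-asym vp<vq (large-decreasing p q p<q (p-large , toℕ<n _) (<-trans p-large vp<vq , toℕ<n _))
    ... | inj₂ (inj₁ _) | inj₁ q-small = s-last q (<-trans s<p p<q) q-small
    ... | inj₂ (inj₁ p-middle) | inj₂ (inj₁ q-middle) =
          <-asym s<p (proj₁ (smalls-inside (ascent p<q vp<vq p-middle q-middle) s-small))
    ... | inj₂ (inj₁ p-middle) | inj₂ (inj₂ q-large) with compare-val i p
    ...   | tri< vi<vp _ _ =
            <-asym p<q (proj₂ (larges-inside (ascent i<p vi<vp i-in p-middle) q-large))
      where
      i<p : i Fin.< p
      i<p = <-trans (proj₁ (smalls-inside middle-ascent s-small)) s<p
    ...   | tri≈ _ refl _ = <-asym s<p (proj₁ (smalls-inside middle-ascent s-small))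
    ...   | tri> _ _ vp<vi =
            <-asym s<p (proj₁ (smalls-inside (ascent p<j (<-trans vp<vi vi<vj) p-middle j-in) s-small))
      where
      p<j : p Fin.< j
      p<j = <-trans p<q (proj₂ (larges-inside middle-ascent q-large))
    split : ∀ {p q} → (toℕ q < suc (toℕ s) ⊎ suc (toℕ s) ≤ toℕ p) → p Fin.< q → ¬ v p < v q
    split (inj₁ q≤s) p<q = before p<q (s≤s⁻¹ q≤s)
    split (inj₂ s<p) p<q = after s<p p<q

  first-large⇒FormII : ∀ {i j r} → AscentIn lo (suc hi) i j → (∀ p → ¬ Small (v p)) →
                       Large (v r) → (∀ q → q Fin.< r → ¬ Large (v q)) → FormII π
  first-large⇒FormII {i} {j} {r} middle-ascent no-small r-large r-first =
    toℕ r , <⇒≤ (toℕ<n r) , λ p q p<q side → descent p<q (split side p<q)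
    where
    open AscentIn middle-ascent
    middle : ∀ p → ¬ Large (v p) → Middle (v p)
    middle p ¬large = ≮⇒≥ (no-small p) , s≤s (≮⇒≥ ¬large)
    before : ∀ {p q} → p Fin.< q → q Fin.< r → ¬ v p < v q
    before {p} {q} p<q q<r vp<vq =
      <-asym q<r (proj₂ (larges-inside (ascent p<q vp<vq (middle p (r-first p (<-trans p<q q<r)))
                                                         (middle q (r-first q q<r))) r-large))
    after : ∀ {p q} → r Fin.≤ p → p Fin.< q → ¬ v p < v q
    after {p} {q} r≤p p<q vp<vq with hi <? v p | hi <? v q
    ... | yes p-large | _ =
          <-asym vp<vq (large-decreasing p q p<q (p-large , toℕ<n _) (<-trans p-large vp<vq , toℕ<n _))
    ... | no ¬p-large | no ¬q-large =
          <⇒≱ (proj₁ (larges-inside (ascent p<q vp<vq (middle p ¬p-large) (middle q ¬q-large)) r-large))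
              r≤p
    ... | no ¬p-large | yes q-large with compare-val i p
    ...   | tri< vi<vp _ _ = <-asym p<q (proj₂ (larges-inside i-p-ascent q-large))
      where
      i-p-ascent : AscentIn lo (suc hi) i p
      i-p-ascent = ascent (<-≤-trans (proj₁ (larges-inside middle-ascent r-large)) r≤p) vi<vp
                          i-in (middle p ¬p-large)
    ...   | tri≈ _ refl _ = <⇒≱ (proj₁ (larges-inside middle-ascent r-large)) r≤p
    ...   | tri> _ _ vp<vi = <⇒≱ (proj₁ (larges-inside p-j-ascent r-large)) r≤p
      where
      p-j-ascent : AscentIn lo (suc hi) p j
      p-j-ascent = ascent (<-trans p<q (proj₂ (larges-inside middle-ascent q-large))) (<-trans vp<vi vi<vj)
                          (middle p ¬p-large) j-in
    split : ∀ {p q} → (toℕ q < toℕ r ⊎ toℕ r ≤ toℕ p) → p Fin.< q → ¬ v p < v q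
    split (inj₁ q<r) p<q = before p<q q<r
    split (inj₂ r≤p) p<q = after r≤p p<q

  all-middle⇒avoids123 : (∀ p → Middle (v p)) → Avoids π p123
  all-middle⇒avoids123 middle (ι , increasing , order) =
    avoid4123 (contains4123 (after-start (<⇒≢ (<-≤-trans v₀<v₂ v₂≤hi))) ι₀<ι₁ ι₁<ι₂
                            v₀<v₁ v₁<v₂ (below-hi ι₁<ι₂ v₂≤hi))
    where
    ι₀<ι₁ = increasing (# 0) (# 1) (s≤s z≤n)
    ι₁<ι₂ = increasing (# 1) (# 2) (s≤s (s≤s z≤n))
    v₀<v₁ = Equivalence.from (order (# 0) (# 1)) (s≤s (s≤s z≤n))
    v₁<v₂ = Equivalence.from (order (# 1) (# 2)) (s≤s (s≤s (s≤s z≤n)))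
    v₀<v₂ = <-trans v₀<v₁ v₁<v₂
    v₂≤hi = s≤s⁻¹ (proj₂ (middle (ι (# 2))))

  form : FormI π ⊎ FormII π
  form with decreasing? lo (suc hi)
  ... | inj₁ middle-decreasing = inj₁ (middle-decreasing⇒FormI middle-decreasing)
  ... | inj₂ (_ , _ , middle-ascent) with searchLast (λ p → v p <? lo)
  ...   | inj₂ (s , s-small , s-last) = inj₂ (last-small⇒FormII middle-ascent s-small s-last)
  ...   | inj₁ no-small with searchFirst (λ p → hi <? v p)
  ...     | inj₂ (r , r-large , r-first) = inj₂ (first-large⇒FormII middle-ascent no-small r-large r-first)
  ...     | inj₁ no-large = avoids123∧3412⇒form {π = π} (all-middle⇒avoids123 middle) avoid3412
    where
    middle : ∀ p → Middle (v p)
    middle p = ≮⇒≥ (no-small p) , s≤s (≮⇒≥ (no-large p))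

corollary6 : (m : ℕ) (π : Permutation′ (suc m)) →
    Avoids π p2341 → Avoids π p4123 → Avoids π p3412 →
    val π zero > val π (fromℕ m) →
    FormI π ⊎ FormII π
corollary6 m π = FirstAboveLast.form {m} {π}
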